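{- $G$ has no $(3,3,4^-)$-face.
   Context: A $(1,1,0)$-coloring of a graph is an assignment of colors from $\{1,2,3\}$ to its vertices such that every vertex of color $1$ has at most one neighbor of color $1$, every vertex of color $2$ has at most one neighbor of color $2$, and no two adjacent vertices both have color $3$. Throughout, $G$ is a fixed plane graph (planar graph with a fixed embedding) containing no cycle of length $4$ or $5$, which has no $(1,1,0)$-coloring but every proper subgraph of which has a $(1,1,0)$-coloring. A $3$-face is a face bounded by a triangle. An $(\ell_1,\ell_2,\ell_3)$-face is a $3$-face whose three vertices have degrees $\ell_1,\ell_2,\ell_3$ (in some order), where an entry $\ell^+$ (resp. $\ell^-$) means degree at least (resp. at most) $\ell$. -}

module Defs where

open import Data.Nat using (ℕ; zero; suc; _+_; _*_; _≤_; _<_)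
open import Data.Bool using (Bool; true; false; _∧_; _∨_; not; if_then_else_)
open import Data.Fin using (Fin; toℕ) renaming (zero to fz; suc to fs)
open import Data.Fin as F using ()
open import Data.Product using (Σ; ∃; _×_; _,_; proj₁; proj₂)
open import Data.Sum using (_⊎_)
open import Relation.Nullary using (¬_)
open import Relation.Nullary.Decidable using (⌊_⌋)
open import Relation.Binary.PropositionalEquality using (_≡_; _≢_; refl)
import Data.Nat as N

count : ∀ {n} → (Fin n → Bool) → ℕ
count {zero}  f = 0
count {suc n} f = (if f fz then 1 else 0) + count (λ i → f (fs i))

anyB : ∀ {n} → (Fin n → Bool) → Bool
anyB {zero}  f = false
anyB {suc n} f = f fz ∨ anyB (λ i → f (fs i))

allB : ∀ {n} → (Fin n → Bool) → Bool
allB {zero}  f = true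
allB {suc n} f = f fz ∧ allB (λ i → f (fs i))

allBelow : ℕ → (ℕ → Bool) → Bool
allBelow zero    p = true
allBelow (suc m) p = allBelow m p ∧ p m

iter : ∀ {A : Set} → (A → A) → ℕ → A → A
iter f zero    x = x
iter f (suc k) x = f (iter f k x)

_==_ : ∀ {n} → Fin n → Fin n → Bool
u == v = ⌊ u F.≟ v ⌋

record Graph (n : ℕ) : Set where
  field
    adj   : Fin n → Fin n → Bool
    sym   : ∀ u v → adj u v ≡ adj v u
    irref : ∀ v → adj v v ≡ false
open Graph public

Adj : ∀ {n} → Graph n → Fin n → Fin n → Set
Adj G u v = adj G u v ≡ true

deg : ∀ {n} → Graph n → Fin n → ℕ
deg G v = count (adj G v)

-- (1,1,0)-colourings of a subgraph of G given by a vertex set keepV and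
-- an edge set keepE (colours 1,2,3 are Fin 3 elements 0,1,2).

record Subgraph {n : ℕ} (G : Graph n) : Set where
  field
    keepV  : Fin n → Bool
    keepE  : Fin n → Fin n → Bool
    E-sym  : ∀ u v → keepE u v ≡ keepE v u
    E-sub  : ∀ u v → keepE u v ≡ true → adj G u v ≡ true
    E-ends : ∀ u v → keepE u v ≡ true → keepV u ≡ true
open Subgraph public

Proper : ∀ {n} {G : Graph n} → Subgraph G → Set
Proper {n} {G} H =
  (∃ λ v → keepV H v ≡ false) ⊎
  (∃ λ u → ∃ λ v → adj G u v ≡ true × keepE H u v ≡ false)

Is110Colouring : ∀ {n} {G : Graph n} → Subgraph G → (Fin n → Fin 3) → Set
Is110Colouring {n} H c =
  (∀ (i : Fin 2) (v u w : Fin n) → keepV H v ≡ true →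
     c v ≡ F.inject₁ i →
     keepE H v u ≡ true → c u ≡ F.inject₁ i →
     keepE H v w ≡ true → c w ≡ F.inject₁ i → u ≡ w) ×
  (∀ (u v : Fin n) → keepE H u v ≡ true → c u ≡ F.fromℕ 2 → c v ≢ F.fromℕ 2)

Colourable110 : ∀ {n} {G : Graph n} → Subgraph G → Set
Colourable110 {n} H = Σ (Fin n → Fin 3) λ c → Is110Colouring H c

whole : ∀ {n} (G : Graph n) → Subgraph G
whole G = record { keepV = λ _ → true ; keepE = adj G ; E-sym = sym G
                 ; E-sub = λ _ _ p → p ; E-ends = λ _ _ _ → refl }

Colourable110G : ∀ {n} → Graph n → Set
Colourable110G G = Colourable110 (whole G)

HasC4 : ∀ {n} → Graph n → Set
HasC4 {n} G = Σ (Fin n × Fin n × Fin n × Fin n) λ { (a , b , c , d) →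
  a ≢ b × a ≢ c × a ≢ d × b ≢ c × b ≢ d × c ≢ d ×
  Adj G a b × Adj G b c × Adj G c d × Adj G d a }

HasC5 : ∀ {n} → Graph n → Set
HasC5 {n} G = Σ (Fin n × Fin n × Fin n × Fin n × Fin n) λ { (a , b , c , d , e) →
  a ≢ b × a ≢ c × a ≢ d × a ≢ e × b ≢ c × b ≢ d × b ≢ e ×
  c ≢ d × c ≢ e × d ≢ e ×
  Adj G a b × Adj G b c × Adj G c d × Adj G d e × Adj G e a }

-- Plane embeddings as combinatorial maps (rotation systems) of genus 0.
-- rot u : the cyclic successor of a neighbour of u in the clockwise order
-- around u.  Darts are ordered pairs (u , v) with u adjacent to v.
-- The face-tracing permutation is φ (u , v) = (v , rot v u); faces are
-- the φ-orbits of darts.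

Dart : ℕ → Set
Dart n = Fin n × Fin n

φ : ∀ {n} → (Fin n → Fin n → Fin n) → Dart n → Dart n
φ rot (u , v) = (v , rot v u)

key : ∀ {n} → Dart n → ℕ
key {n} (u , v) = toℕ u * n + toℕ v

sumFin : ∀ {n} → (Fin n → ℕ) → ℕ
sumFin {zero}  f = 0
sumFin {suc n} f = f fz + sumFin (λ i → f (fs i))

count2 : ∀ {n} → (Fin n → Fin n → Bool) → ℕ
count2 f = sumFin (λ u → count (f u))

-- dart d is the key-minimal dart of its φ-orbit (orbits have length ≤ n*n)
faceRep : ∀ {n} → (Fin n → Fin n → Fin n) → Dart n → Bool
faceRep {n} rot d = allBelow (n * n) (λ k → key d N.≤ᵇ key (iter (φ rot) k d))

reach : ∀ {n} → Graph n → ℕ → Fin n → Fin n → Bool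
reach G zero    u v = u == v
reach G (suc k) u v = reach G k u v ∨ anyB (λ w → reach G k u w ∧ adj G w v)

numV numD numIso numComp : ∀ {n} → Graph n → ℕ
numV {n} G = n
numD G = count2 (adj G)
numIso G = count (λ v → deg G v N.≡ᵇ 0)
numComp {n} G = count (λ v → not (anyB (λ u → (toℕ u N.<ᵇ toℕ v) ∧ reach G n u v)))

numF : ∀ {n} → Graph n → (Fin n → Fin n → Fin n) → ℕ
numF G rot = count2 (λ u v → adj G u v ∧ faceRep rot (u , v))

record PlaneEmbedding {n : ℕ} (G : Graph n) : Set where
  field
    rot     : Fin n → Fin n → Fin n
    rot-nbr : ∀ u v → Adj G u v → Adj G u (rot u v)
    rot-cyc : ∀ u v w → Adj G u v → Adj G u w → ∃ λ k → iter (rot u) k v ≡ w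
    -- Euler's formula for genus 0, summed over components:
    -- V - E + F + (#isolated vertices) = 2 (#components), with E = D/2
    euler   : 2 * numV G + 2 * numF G rot + 2 * numIso G ≡ 4 * numComp G + numD G
open PlaneEmbedding public

-- (u , v , w) bounds a 3-face: the facial walk u → v → w → u is a φ-orbit
Is3Face : ∀ {n} {G : Graph n} → PlaneEmbedding G → Fin n → Fin n → Fin n → Set
Is3Face {G = G} P u v w =
  Adj G u v × rot P v u ≡ w × rot P w v ≡ u × rot P u w ≡ v

Is334⁻ : ℕ → ℕ → ℕ → Set
Is334⁻ a b c = (a ≡ 3 × b ≡ 3 × c ≤ 4) ⊎ (a ≡ 3 × c ≡ 3 × b ≤ 4) ⊎ (b ≡ 3 × c ≡ 3 × a ≤ 4)

module Submission where

-- A minimal non-(1,1,0)-colourable graph has no triangle u v w with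
-- deg u = deg v = 3 and deg w ≤ 4.
--
-- Colour G − {u, v} by minimality, with colouring c.  Let x and y be
-- the neighbours of u and v outside the triangle.  We recolour u, v and
-- possibly w so that (i) u avoids c x and v avoids c y, (ii) the triangle
-- satisfies the (1,1,0) rule among its own corners, and (iii) either the new
-- colour of w is absent from w's other neighbours, or w keeps its colour and
-- gains no monochromatic triangle-mate.  A short case analysis on c w, c x,
-- c y finds such colours; in the hardest case deg w ≤ 4 is used: w has at
-- most two neighbours besides u and v, so they miss some colour.

open import Defs
open import Data.Nat using (ℕ)
open import Data.Fin using (Fin)
open import Data.Product using (_×_)
open import Relation.Nullary using (¬_)

open import Data.Nat using (suc; _+_; _≤_; s≤s; z≤n)
open import Data.Nat.Properties using (+-suc; suc-injective; n≮n; ≤-trans)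
open import Data.Bool using (Bool; true; false; _∧_; not; if_then_else_)
import Data.Bool as Bool
open import Data.Bool.Properties using (∧-comm)
open import Data.Fin using () renaming (zero to fz; suc to fs)
import Data.Fin as F
import Data.Fin.Properties as FP
open import Data.List using (List; []; _∷_; length)
open import Data.List.Relation.Unary.All using (All; []; _∷_)
import Data.List.Relation.Unary.All as All
open import Data.List.Relation.Unary.AllPairs using ([]; _∷_)
open import Data.List.Relation.Unary.Unique.Propositional using (Unique)
open import Data.Product using (∃-syntax; _,_; proj₁; proj₂; swap)
open import Data.Sum using (_⊎_; inj₁; inj₂) renaming (swap to ⊎-swap)
open import Data.Empty using (⊥; ⊥-elim)
open import Function using (_∘_)
open import Relation.Nullary using (Dec; yes; no)
open import Relation.Nullary.Decidable using (_×-dec_; ¬?)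
open import Relation.Binary.PropositionalEquality
  using (_≡_; _≢_; refl; trans; cong; cong₂; subst; ≢-sym) renaming (sym to ≡-sym)
open Relation.Binary.PropositionalEquality.≡-Reasoning

==-refl : ∀ {n} (a : Fin n) → (a == a) ≡ true
==-refl a with a F.≟ a
... | yes _   = refl
... | no a≢a = ⊥-elim (a≢a refl)

==-≢ : ∀ {n} {a b : Fin n} → a ≢ b → (a == b) ≡ false
==-≢ {a = a} {b} a≢b with a F.≟ b
... | yes a≡b = ⊥-elim (a≢b a≡b)
... | no _    = refl

≢-respect : ∀ {A : Set} {a a' k k' : A} → a ≡ k → a' ≡ k' → k ≢ k' → a ≢ a'
≢-respect refl refl k≢k' = k≢k'

∧-true : ∀ {a b : Bool} → a ∧ b ≡ true → a ≡ true × b ≡ true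
∧-true {true} {true} refl = refl , refl

-- f with the point a deleted (by structural recursion, so that it commutes
-- with the recursion of count)
remove : ∀ {n} → (Fin n → Bool) → Fin n → Fin n → Bool
remove f fz     fz     = false
remove f fz     (fs t) = f (fs t)
remove f (fs a) fz     = f fz
remove f (fs a) (fs t) = remove (f ∘ fs) a t

remove-keeps : ∀ {n} (f : Fin n → Bool) {a t : Fin n} →
  f t ≡ true → t ≢ a → remove f a t ≡ true
remove-keeps f {fz}   {fz}   _  t≢a = ⊥-elim (t≢a refl)
remove-keeps f {fz}   {fs t} ft _   = ft
remove-keeps f {fs a} {fz}   ft _   = ft
remove-keeps f {fs a} {fs t} ft t≢a = remove-keeps (f ∘ fs) ft (t≢a ∘ cong fs)

remove-⊆ : ∀ {n} (f : Fin n → Bool) {a t : Fin n} →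
  remove f a t ≡ true → f t ≡ true × t ≢ a
remove-⊆ f {fz}   {fs t} ft = ft , λ ()
remove-⊆ f {fs a} {fz}   ft = ft , λ ()
remove-⊆ f {fs a} {fs t} rt =
  let (ft , t≢a) = remove-⊆ (f ∘ fs) rt in ft , t≢a ∘ FP.suc-injective

count-remove : ∀ {n} (f : Fin n → Bool) (a : Fin n) →
  f a ≡ true → count f ≡ suc (count (remove f a))
count-remove f fz     fa rewrite fa = refl
count-remove f (fs a) fa =
  trans (cong ((if f fz then 1 else 0) +_) (count-remove (f ∘ fs) a fa))
        (+-suc (if f fz then 1 else 0) (count (remove (f ∘ fs) a)))

count-suc⇒point : ∀ {n} (f : Fin n → Bool) {k} → count f ≡ suc k → ∃[ a ] f a ≡ true
count-suc⇒point {suc n} f eq with f fz in f0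
... | true  = fz , f0
... | false = let (a , fa) = count-suc⇒point (f ∘ fs) eq in fs a , fa

distinct≤count : ∀ {n} (f : Fin n → Bool) (xs : List (Fin n)) →
  Unique xs → All (λ t → f t ≡ true) xs → length xs ≤ count f
distinct≤count f [] _ _ = z≤n
distinct≤count f (x ∷ xs) (x≢xs ∷ unique) (fx ∷ fxs)
  rewrite count-remove f x fx =
  s≤s (distinct≤count (remove f x) xs unique
        (All.zipWith (λ (x≢t , ft) → remove-keeps f ft (≢-sym x≢t)) (x≢xs , fxs)))

thirdPoint : ∀ {n} (f : Fin n → Bool) {v w : Fin n} →
  count f ≡ 3 → f v ≡ true → f w ≡ true → v ≢ w →
  ∃[ x ] f x ≡ true × x ≢ v × x ≢ w × (∀ t → f t ≡ true → t ≡ v ⊎ t ≡ w ⊎ t ≡ x)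
thirdPoint f {v} {w} count≡3 fv fw v≢w = x , fx , x≢v , x≢w , onlyThree
  where
  g : Fin _ → Bool
  g = remove (remove f v) w

  count-g : count g ≡ 1
  count-g = suc-injective (suc-injective (begin
    suc (suc (count g))     ≡⟨ cong suc (count-remove (remove f v) w
                                 (remove-keeps f fw (≢-sym v≢w))) ⟨
    suc (count (remove f v)) ≡⟨ count-remove f v fv ⟨
    count f                  ≡⟨ count≡3 ⟩
    3                        ∎))

  x : Fin _
  x = proj₁ (count-suc⇒point g count-g)

  x-in-remove : remove f v x ≡ true × x ≢ w
  x-in-remove = remove-⊆ (remove f v) {w} (proj₂ (count-suc⇒point g count-g))

  fx : f x ≡ true
  fx = proj₁ (remove-⊆ f {v} (proj₁ x-in-remove))

  x≢v : x ≢ v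
  x≢v = proj₂ (remove-⊆ f {v} (proj₁ x-in-remove))

  x≢w : x ≢ w
  x≢w = proj₂ x-in-remove

  onlyThree : ∀ t → f t ≡ true → t ≡ v ⊎ t ≡ w ⊎ t ≡ x
  onlyThree t ft with t F.≟ v | t F.≟ w | t F.≟ x
  ... | yes t≡v | _       | _       = inj₁ t≡v
  ... | no _    | yes t≡w | _       = inj₂ (inj₁ t≡w)
  ... | no _    | no _    | yes t≡x = inj₂ (inj₂ t≡x)
  ... | no t≢v  | no t≢w  | no t≢x  = ⊥-elim (4≰3 (distinct≤count f (v ∷ w ∷ x ∷ t ∷ [])
          ((v≢w ∷ ≢-sym x≢v ∷ ≢-sym t≢v ∷ []) ∷ (≢-sym x≢w ∷ ≢-sym t≢w ∷ []) ∷
           (≢-sym t≢x ∷ []) ∷ [] ∷ [])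
          (fv ∷ fw ∷ fx ∷ ft ∷ [])))
    where
    4≰3 : ¬ (4 ≤ count f)
    4≰3 le = n≮n 3 (subst (4 ≤_) count≡3 le)

adj⇒≢ : ∀ {n} (G : Graph n) {a b : Fin n} → Adj G a b → a ≢ b
adj⇒≢ G {a} ab refl with trans (≡-sym ab) (irref G a)
... | ()

adj-sym : ∀ {n} (G : Graph n) {a b : Fin n} → Adj G a b → Adj G b a
adj-sym G {a} {b} ab = trans (Graph.sym G b a) ab

survives : ∀ {n} → Fin n → Fin n → Fin n → Bool
survives u v t = not (t == u) ∧ not (t == v)

delete2 : ∀ {n} (G : Graph n) (u v : Fin n) → Subgraph G
delete2 G u v = record
  { keepV  = survives u v
  ; keepE  = λ s t → adj G s t ∧ (survives u v s ∧ survives u v t)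
  ; E-sym  = λ s t → cong₂ _∧_ (Graph.sym G s t) (∧-comm (survives u v s) (survives u v t))
  ; E-sub  = λ s t st → proj₁ (∧-true st)
  ; E-ends = λ s t st → proj₁ (∧-true (proj₂ (∧-true {adj G s t} st)))
  }

delete2-proper : ∀ {n} (G : Graph n) (u v : Fin n) → Proper (delete2 G u v)
delete2-proper G u v = inj₁ (u , cong (λ b → not b ∧ not (u == v)) (==-refl u))

delete2-edge : ∀ {n} (G : Graph n) {u v s t : Fin n} → Adj G s t →
  s ≢ u → s ≢ v → t ≢ u → t ≢ v → keepE (delete2 G u v) s t ≡ true
delete2-edge G st s≢u s≢v t≢u t≢v =
  cong₂ _∧_ st (cong₂ _∧_ (survives-≢ s≢u s≢v) (survives-≢ t≢u t≢v))
  where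
  survives-≢ : ∀ {n} {u v t : Fin n} → t ≢ u → t ≢ v → survives u v t ≡ true
  survives-≢ t≢u t≢v = cong₂ (λ p q → not p ∧ not q) (==-≢ t≢u) (==-≢ t≢v)

-- colour 3, the colour whose class must be independent; the other two
-- colours are "relaxed" (each vertex may have one neighbour of its colour)
c₃ : Fin 3
c₃ = fs (fs fz)

relaxed⇒inject : ∀ k → k ≢ c₃ → ∃[ i ] F.inject₁ i ≡ k
relaxed⇒inject fz           _     = fz , refl
relaxed⇒inject (fs fz)      _     = fs fz , refl
relaxed⇒inject (fs (fs fz)) k≢c₃ = ⊥-elim (k≢c₃ refl)

avoid : Fin 3 → Fin 3
avoid fz = fs fz
avoid _  = fz

avoid-≢ : ∀ k → avoid k ≢ k
avoid-≢ fz           ()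
avoid-≢ (fs fz)      ()
avoid-≢ (fs (fs fz)) ()

avoid-relaxed : ∀ k → avoid k ≢ c₃
avoid-relaxed fz           ()
avoid-relaxed (fs fz)      ()
avoid-relaxed (fs (fs fz)) ()

module _ {n : ℕ} {G : Graph n} (H : Subgraph G) (κ : Fin n → Fin 3) where

  Mono : Fin n → Fin n → Set
  Mono p q = keepE H p q ≡ true × κ q ≡ κ p

  ProperAt : Fin n → Set
  ProperAt p = ∀ q → Mono p q → κ p ≢ c₃ × (∀ r → Mono p r → q ≡ r)

  colouring⇒properAt : Is110Colouring H κ → ∀ p → ProperAt p
  colouring⇒properAt (relaxedOK , independent) p q (pq , κq) = κp≢c₃ , unique
    where
    κp≢c₃ : κ p ≢ c₃
    κp≢c₃ κp = independent p q pq κp (trans κq κp)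

    unique : ∀ r → Mono p r → q ≡ r
    unique r (pr , κr) =
      let (i , i≡κp) = relaxed⇒inject (κ p) κp≢c₃ in
      relaxedOK i p q r (E-ends H p q pq) (≡-sym i≡κp)
        pq (trans κq (≡-sym i≡κp)) pr (trans κr (≡-sym i≡κp))

  properAt⇒colouring : (∀ p → ProperAt p) → Is110Colouring H κ
  properAt⇒colouring proper = relaxedOK , independent
    where
    relaxedOK : ∀ (i : Fin 2) p q r → keepV H p ≡ true → κ p ≡ F.inject₁ i →
      keepE H p q ≡ true → κ q ≡ F.inject₁ i →
      keepE H p r ≡ true → κ r ≡ F.inject₁ i → q ≡ r
    relaxedOK i p q r _ κp pq κq pr κr =
      proj₂ (proper p q (pq , trans κq (≡-sym κp))) r (pr , trans κr (≡-sym κp))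

    independent : ∀ p q → keepE H p q ≡ true → κ p ≡ c₃ → κ q ≢ c₃
    independent p q pq κp κq = proj₁ (proper p q (pq , trans κq (≡-sym κp))) κp

properAt-transfer : ∀ {n} {G : Graph n} (H H' : Subgraph G) (κ κ' : Fin n → Fin 3) p →
  ProperAt H κ p → κ' p ≡ κ p → (∀ q → Mono H' κ' p q → Mono H κ p q) →
  ProperAt H' κ' p
properAt-transfer H H' κ κ' p old same mono⊆ q mq =
  (λ κ'p≡c₃ → proj₁ (old q (mono⊆ q mq)) (trans (≡-sym same) κ'p≡c₃)) ,
  (λ r mr → proj₂ (old q (mono⊆ q mq)) r (mono⊆ r mr))

-- The rule at a triangle corner of colour k, restricted to its two
-- triangle-mates, of colours k₁ and k₂.
CornerOK : Fin 3 → Fin 3 → Fin 3 → Set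
CornerOK k k₁ k₂ = (k₁ ≡ k → k ≢ c₃ × k₂ ≢ k) × (k₂ ≡ k → k ≢ c₃ × k₁ ≢ k)

-- The rule restricted to the triangle itself: no two corners of colour 3
-- and no monochromatic triangle.
TriangleOK : Fin 3 → Fin 3 → Fin 3 → Set
TriangleOK a b c = CornerOK a b c × CornerOK b a c × CornerOK c a b

corner-distinct : ∀ {k k₁ k₂} → k₁ ≢ k → k₂ ≢ k → CornerOK k k₁ k₂
corner-distinct k₁≢k k₂≢k = (⊥-elim ∘ k₁≢k) , (⊥-elim ∘ k₂≢k)

corner-relaxed : ∀ {k k₁ k₂} → k ≢ c₃ → k₂ ≢ k → CornerOK k k₁ k₂
corner-relaxed k≢c₃ k₂≢k = (λ _ → k≢c₃ , k₂≢k) , (⊥-elim ∘ k₂≢k)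

triangle-rotate : ∀ {a b c} → TriangleOK a b c → TriangleOK c a b
triangle-rotate (okA , okB , okC) = okC , swap okA , swap okB

triangle-rainbow : ∀ {a b c} → a ≢ b → a ≢ c → b ≢ c → TriangleOK a b c
triangle-rainbow a≢b a≢c b≢c =
  corner-distinct (≢-sym a≢b) (≢-sym a≢c) ,
  corner-distinct a≢b (≢-sym b≢c) ,
  corner-distinct a≢c b≢c

triangle-pair : ∀ {a c} → a ≢ c₃ → c ≢ a → TriangleOK a a c
triangle-pair a≢c₃ c≢a =
  corner-relaxed a≢c₃ c≢a , corner-relaxed a≢c₃ c≢a ,
  corner-distinct (≢-sym c≢a) (≢-sym c≢a)

triangle-relaxed3 : ∀ {a b} → a ≢ c₃ → b ≢ c₃ → TriangleOK a b c₃
triangle-relaxed3 a≢c₃ b≢c₃ =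
  corner-relaxed a≢c₃ (≢-sym a≢c₃) , corner-relaxed b≢c₃ (≢-sym b≢c₃) ,
  corner-distinct a≢c₃ b≢c₃

mono-candidate : ∀ {n} {G : Graph n} (H : Subgraph G) (κ : Fin n → Fin 3) p a b →
  (∀ r → Mono H κ p r → r ≡ a ⊎ r ≡ b) → CornerOK (κ p) (κ a) (κ b) →
  Mono H κ p a → κ p ≢ c₃ × (∀ r → Mono H κ p r → a ≡ r)
mono-candidate H κ p a b only (okA , _) (_ , κa) =
  proj₁ (okA κa) , λ r mr → pin (only r mr) (proj₂ mr)
  where
  pin : ∀ {r} → r ≡ a ⊎ r ≡ b → κ r ≡ κ p → a ≡ r
  pin (inj₁ refl) _  = refl
  pin (inj₂ refl) κb = ⊥-elim (proj₂ (okA κa) κb)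

properAt-corner : ∀ {n} {G : Graph n} (H : Subgraph G) (κ : Fin n → Fin 3) p q₁ q₂ →
  (∀ q → Mono H κ p q → q ≡ q₁ ⊎ q ≡ q₂) → CornerOK (κ p) (κ q₁) (κ q₂) →
  ProperAt H κ p
properAt-corner H κ p q₁ q₂ only ok q mq with only q mq
... | inj₁ refl = mono-candidate H κ p q₁ q₂ only ok mq
... | inj₂ refl = mono-candidate H κ p q₂ q₁ (λ r mr → ⊎-swap (only r mr)) (swap ok) mq

properAt-degree3 : ∀ {n} (G : Graph n) (κ : Fin n → Fin 3) p q₁ q₂ z →
  (∀ t → Adj G p t → t ≡ q₁ ⊎ t ≡ q₂ ⊎ t ≡ z) → κ z ≢ κ p →
  CornerOK (κ p) (κ q₁) (κ q₂) → ProperAt (whole G) κ p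
properAt-degree3 G κ p q₁ q₂ z nbrs z-differs =
  properAt-corner (whole G) κ p q₁ q₂ mates
  where
  mates : ∀ q → Mono (whole G) κ p q → q ≡ q₁ ⊎ q ≡ q₂
  mates q (pq , same) with nbrs q pq
  ... | inj₁ q≡q₁         = inj₁ q≡q₁
  ... | inj₂ (inj₁ q≡q₂)  = inj₂ q≡q₂
  ... | inj₂ (inj₂ refl)  = ⊥-elim (z-differs same)

module Extension {n : ℕ} (G : Graph n) (u v w : Fin n)
  (uv : Adj G u v) (uw : Adj G u w) (vw : Adj G v w)
  (x : Fin n) (x≢u : x ≢ u) (x≢v : x ≢ v) (x≢w : x ≢ w)
  (nbrs-u : ∀ t → Adj G u t → t ≡ v ⊎ t ≡ w ⊎ t ≡ x)
  (y : Fin n) (y≢u : y ≢ u) (y≢v : y ≢ v) (y≢w : y ≢ w)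
  (nbrs-v : ∀ t → Adj G v t → t ≡ u ⊎ t ≡ w ⊎ t ≡ y)
  (c : Fin n → Fin 3) (c-proper : ∀ p → ProperAt (delete2 G u v) c p)
  where

  u≢v : u ≢ v
  u≢v = adj⇒≢ G uv

  w≢u : w ≢ u
  w≢u = ≢-sym (adj⇒≢ G uw)

  w≢v : w ≢ v
  w≢v = ≢-sym (adj⇒≢ G vw)

  OtherNbr : Fin n → Set
  OtherNbr t = Adj G w t × t ≢ u × t ≢ v

  Fresh : Fin 3 → Set
  Fresh k = ∀ t → OtherNbr t → c t ≢ k

  record Recolouring : Set where
    field
      cu cv cw   : Fin 3
      u-avoids-x : cu ≢ c x
      v-avoids-y : cv ≢ c y
      triangle   : TriangleOK cu cv cw
      w-safe     : Fresh cw ⊎ (cw ≡ c w × cu ≢ cw × cv ≢ cw)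

  module Recoloured (R : Recolouring) where
    open Recolouring R

    -- c' is used only through the four equations below
    opaque
      c' : Fin n → Fin 3
      c' t = if t == u then cu else if t == v then cv else if t == w then cw else c t

      c'-u : c' u ≡ cu
      c'-u rewrite ==-refl u = refl

      c'-v : c' v ≡ cv
      c'-v rewrite ==-≢ (≢-sym u≢v) | ==-refl v = refl

      c'-w : c' w ≡ cw
      c'-w rewrite ==-≢ w≢u | ==-≢ w≢v | ==-refl w = refl

      c'-off : ∀ {t} → t ≢ u → t ≢ v → t ≢ w → c' t ≡ c t
      c'-off t≢u t≢v t≢w rewrite ==-≢ t≢u | ==-≢ t≢v | ==-≢ t≢w = refl

    triangle' : TriangleOK (c' u) (c' v) (c' w)
    triangle' rewrite c'-u | c'-v | c'-w = triangle

    x-differs : c' x ≢ c' u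
    x-differs same = u-avoids-x (begin
      cu   ≡⟨ c'-u ⟨
      c' u ≡⟨ same ⟨
      c' x ≡⟨ c'-off x≢u x≢v x≢w ⟩
      c x  ∎)

    y-differs : c' y ≢ c' v
    y-differs same = v-avoids-y (begin
      cv   ≡⟨ c'-v ⟨
      c' v ≡⟨ same ⟨
      c' y ≡⟨ c'-off y≢u y≢v y≢w ⟩
      c y  ∎)

    proper-w : ProperAt (whole G) c' w
    proper-w with w-safe
    ... | inj₁ fresh = properAt-corner (whole G) c' w u v mates (proj₂ (proj₂ triangle'))
      where
      -- the new colour of w is fresh, so only u and v can share it
      mates : ∀ q → Mono (whole G) c' w q → q ≡ u ⊎ q ≡ v
      mates q (wq , same) with q F.≟ u | q F.≟ v
      ... | yes q≡u | _       = inj₁ q≡u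
      ... | no _    | yes q≡v = inj₂ q≡v
      ... | no q≢u  | no q≢v  = ⊥-elim (fresh q (wq , q≢u , q≢v) (begin
        c q  ≡⟨ c'-off q≢u q≢v (≢-sym (adj⇒≢ G wq)) ⟨
        c' q ≡⟨ same ⟩
        c' w ≡⟨ c'-w ⟩
        cw   ∎))
    ... | inj₂ (kept , u≢cw , v≢cw) =
      properAt-transfer (delete2 G u v) (whole G) c c' w (c-proper w) (trans c'-w kept) unchanged
      where
      -- w keeps its colour and u, v do not share it: nothing new around w
      unchanged : ∀ q → Mono (whole G) c' w q → Mono (delete2 G u v) c w q
      unchanged q (wq , same) = delete2-edge G wq w≢u w≢v q≢u q≢v , (begin
        c q  ≡⟨ c'-off q≢u q≢v (≢-sym (adj⇒≢ G wq)) ⟨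
        c' q ≡⟨ same ⟩
        c' w ≡⟨ c'-w ⟩
        cw   ≡⟨ kept ⟩
        c w  ∎)
        where
        notMate : ∀ {s k} → c' s ≡ k → k ≢ cw → q ≢ s
        notMate c's k≢cw q≡s =
          k≢cw (trans (≡-sym c's) (trans (cong c' (≡-sym q≡s)) (trans same c'-w)))

        q≢u : q ≢ u
        q≢u = notMate c'-u u≢cw

        q≢v : q ≢ v
        q≢v = notMate c'-v v≢cw

    proper-off : ∀ p → p ≢ u → p ≢ v → p ≢ w → ProperAt (whole G) c' p
    proper-off p p≢u p≢v p≢w =
      properAt-transfer (delete2 G u v) (whole G) c c' p (c-proper p) c'p unchanged
      where
      c'p : c' p ≡ c p
      c'p = c'-off p≢u p≢v p≢w

      unchanged : ∀ q → Mono (whole G) c' p q → Mono (delete2 G u v) c p q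
      unchanged q (pq , same) =
        delete2-edge G pq p≢u p≢v q≢u q≢v , oldColour (q F.≟ w)
        where
        -- q is not a degree-3 corner s, whose only outside neighbour z
        -- has a colour different from s
        notCorner : ∀ {s a b z} → (∀ t → Adj G s t → t ≡ a ⊎ t ≡ b ⊎ t ≡ z) →
          p ≢ a → p ≢ b → c' z ≢ c' s → q ≢ s
        notCorner {s} {z = z} nbrs p≢a p≢b z-differs q≡s
          with nbrs p (adj-sym G (subst (Adj G p) q≡s pq))
        ... | inj₁ p≡a        = p≢a p≡a
        ... | inj₂ (inj₁ p≡b) = p≢b p≡b
        ... | inj₂ (inj₂ p≡z) = z-differs (begin
          c' z ≡⟨ cong c' p≡z ⟨
          c' p ≡⟨ same ⟨
          c' q ≡⟨ cong c' q≡s ⟩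
          c' s ∎)

        q≢u : q ≢ u
        q≢u = notCorner nbrs-u p≢v p≢w x-differs

        q≢v : q ≢ v
        q≢v = notCorner nbrs-v p≢u p≢w y-differs

        oldColour : Dec (q ≡ w) → c q ≡ c p
        oldColour (no q≢w) = begin
          c q  ≡⟨ c'-off q≢u q≢v q≢w ⟨
          c' q ≡⟨ same ⟩
          c' p ≡⟨ c'p ⟩
          c p  ∎
        oldColour (yes q≡w) with w-safe
        ... | inj₁ fresh = ⊥-elim (fresh p (adj-sym G (subst (Adj G p) q≡w pq) , p≢u , p≢v) (begin
          c p  ≡⟨ c'p ⟨
          c' p ≡⟨ same ⟨
          c' q ≡⟨ cong c' q≡w ⟩
          c' w ≡⟨ c'-w ⟩
          cw   ∎))
        ... | inj₂ (kept , _ , _) = begin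
          c q  ≡⟨ cong c q≡w ⟩
          c w  ≡⟨ kept ⟨
          cw   ≡⟨ c'-w ⟨
          c' w ≡⟨ cong c' q≡w ⟨
          c' q ≡⟨ same ⟩
          c' p ≡⟨ c'p ⟩
          c p  ∎

    proper : ∀ p → ProperAt (whole G) c' p
    proper p with p F.≟ u | p F.≟ v | p F.≟ w
    ... | yes refl | _        | _        =
      properAt-degree3 G c' u v w x nbrs-u x-differs (proj₁ triangle')
    ... | no _     | yes refl | _        =
      properAt-degree3 G c' v u w y nbrs-v y-differs (proj₁ (proj₂ triangle'))
    ... | no _     | no _     | yes refl = proper-w
    ... | no p≢u   | no p≢v   | no p≢w   = proper-off p p≢u p≢v p≢w

  extend : Recolouring → Colourable110G G
  extend R = c' , properAt⇒colouring (whole G) c' proper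
    where open Recoloured R

  fresh? : ∀ k → Fresh k ⊎ ∃[ t ] OtherNbr t × c t ≡ k
  fresh? k with FP.any? (λ t → (adj G w t Bool.≟ true) ×-dec ¬? (t F.≟ u) ×-dec
                              ¬? (t F.≟ v) ×-dec (c t F.≟ k))
  ... | yes (t , wt , t≢u , t≢v , ct) = inj₂ (t , (wt , t≢u , t≢v) , ct)
  ... | no none = inj₁ λ t (wt , t≢u , t≢v) ct → none (t , wt , t≢u , t≢v , ct)

  -- If deg w ≤ 4 then w has at most two neighbours besides u and v, so its
  -- neighbours in G − {u, v} carry at most two colours.
  twoColours : deg G w ≤ 4 → ∀ {t₁ t₂ t₃} → OtherNbr t₁ → OtherNbr t₂ → OtherNbr t₃ →
    c t₁ ≢ c t₂ → c t₁ ≢ c t₃ → c t₂ ≢ c t₃ → ⊥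
  twoColours deg≤4 (wt₁ , t₁≢u , t₁≢v) (wt₂ , t₂≢u , t₂≢v) (wt₃ , t₃≢u , t₃≢v) c₁₂ c₁₃ c₂₃ =
    n≮n 4 (≤-trans (distinct≤count (adj G w) (u ∷ v ∷ _ ∷ _ ∷ _ ∷ [])
      ((u≢v ∷ ≢-sym t₁≢u ∷ ≢-sym t₂≢u ∷ ≢-sym t₃≢u ∷ []) ∷
       (≢-sym t₁≢v ∷ ≢-sym t₂≢v ∷ ≢-sym t₃≢v ∷ []) ∷
       (c₁₂ ∘ cong c ∷ c₁₃ ∘ cong c ∷ []) ∷ (c₂₃ ∘ cong c ∷ []) ∷ [] ∷ [])
      (adj-sym G uw ∷ adj-sym G vw ∷ wt₁ ∷ wt₂ ∷ wt₃ ∷ [])) deg≤4)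

  -- c w = 3: give u and v relaxed colours avoiding c x and c y.
  recolour-c₃ : c w ≡ c₃ → Recolouring
  recolour-c₃ cw≡c₃ = record
    { cu = avoid (c x) ; cv = avoid (c y) ; cw = c₃
    ; u-avoids-x = avoid-≢ (c x)
    ; v-avoids-y = avoid-≢ (c y)
    ; triangle   = triangle-relaxed3 (avoid-relaxed (c x)) (avoid-relaxed (c y))
    ; w-safe     = inj₂ (≡-sym cw≡c₃ , avoid-relaxed (c x) , avoid-relaxed (c y))
    }

  recolour-relaxed : deg G w ≤ 4 → ∀ {a b} → c w ≡ a → a ≢ b → a ≢ c₃ → b ≢ c₃ →
    Recolouring
  recolour-relaxed deg≤4 {a} {b} cw≡a a≢b a≢c₃ b≢c₃ with c x F.≟ b | c y F.≟ b
  ... | no x≢b | no y≢b = record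
    { cu = b ; cv = b ; cw = a
    ; u-avoids-x = ≢-sym x≢b
    ; v-avoids-y = ≢-sym y≢b
    ; triangle   = triangle-pair b≢c₃ a≢b
    ; w-safe     = inj₂ (≡-sym cw≡a , ≢-sym a≢b , ≢-sym a≢b)
    }
  ... | no x≢b | yes y≡b = record
    { cu = b ; cv = c₃ ; cw = a
    ; u-avoids-x = ≢-sym x≢b
    ; v-avoids-y = ≢-respect refl y≡b (≢-sym b≢c₃)
    ; triangle   = triangle-rainbow b≢c₃ (≢-sym a≢b) (≢-sym a≢c₃)
    ; w-safe     = inj₂ (≡-sym cw≡a , ≢-sym a≢b , ≢-sym a≢c₃)
    }
  ... | yes x≡b | no y≢b = record
    { cu = c₃ ; cv = b ; cw = a
    ; u-avoids-x = ≢-respect refl x≡b (≢-sym b≢c₃)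
    ; v-avoids-y = ≢-sym y≢b
    ; triangle   = triangle-rainbow (≢-sym b≢c₃) (≢-sym a≢c₃) (≢-sym a≢b)
    ; w-safe     = inj₂ (≡-sym cw≡a , ≢-sym a≢c₃ , ≢-sym a≢b)
    }
  ... | yes x≡b | yes y≡b = blocked (fresh? a) (fresh? c₃)
    where
    blocked : Fresh a ⊎ ∃[ t ] OtherNbr t × c t ≡ a →
              Fresh c₃ ⊎ ∃[ t ] OtherNbr t × c t ≡ c₃ → Recolouring
    blocked (inj₁ fresh-a) _ = record
      { cu = c₃ ; cv = a ; cw = a
      ; u-avoids-x = ≢-respect refl x≡b (≢-sym b≢c₃)
      ; v-avoids-y = ≢-respect refl y≡b a≢b
      ; triangle   = triangle-rotate (triangle-pair a≢c₃ (≢-sym a≢c₃))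
      ; w-safe     = inj₁ fresh-a
      }
    blocked (inj₂ _) (inj₁ fresh-c₃) = record
      { cu = a ; cv = a ; cw = c₃
      ; u-avoids-x = ≢-respect refl x≡b a≢b
      ; v-avoids-y = ≢-respect refl y≡b a≢b
      ; triangle   = triangle-pair a≢c₃ (≢-sym a≢c₃)
      ; w-safe     = inj₁ fresh-c₃
      }
    blocked (inj₂ (t₁ , nbr₁ , ct₁)) (inj₂ (t₂ , nbr₂ , ct₂)) = record
      { cu = c₃ ; cv = a ; cw = b
      ; u-avoids-x = ≢-respect refl x≡b (≢-sym b≢c₃)
      ; v-avoids-y = ≢-respect refl y≡b a≢b
      ; triangle   = triangle-rainbow (≢-sym a≢c₃) (≢-sym b≢c₃) a≢b
      ; w-safe     = inj₁ fresh-b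
      }
      where
      -- w already sees colours a and 3 outside the triangle
      fresh-b : Fresh b
      fresh-b t nbr ct = twoColours deg≤4 nbr₁ nbr₂ nbr
        (≢-respect ct₁ ct₂ a≢c₃) (≢-respect ct₁ ct a≢b) (≢-respect ct₂ ct (≢-sym b≢c₃))

  recolouring : deg G w ≤ 4 → Recolouring
  recolouring deg≤4 with c w in cw≡
  ... | fz           = recolour-relaxed deg≤4 {b = fs fz} cw≡ (λ ()) (λ ()) (λ ())
  ... | fs fz        = recolour-relaxed deg≤4 {b = fz} cw≡ (λ ()) (λ ()) (λ ())
  ... | fs (fs fz)   = recolour-c₃ cw≡

noReducibleTriangle : ∀ {n} (G : Graph n) → ¬ Colourable110G G →
  (∀ (H : Subgraph G) → Proper H → Colourable110 H) →
  ∀ u v w → Adj G u v → Adj G u w → Adj G v w →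
  deg G u ≡ 3 → deg G v ≡ 3 → deg G w ≤ 4 → ⊥
noReducibleTriangle G uncolourable minimal u v w uv uw vw deg-u deg-v deg≤4
  with thirdPoint (adj G u) deg-u uv uw (adj⇒≢ G vw)
     | thirdPoint (adj G v) deg-v (adj-sym G uv) vw (adj⇒≢ G uw)
     | minimal (delete2 G u v) (delete2-proper G u v)
... | x , ux , x≢v , x≢w , nbrs-u | y , vy , y≢u , y≢w , nbrs-v | c , c-colouring =
  uncolourable (extend (recolouring deg≤4))
  where
  open Extension G u v w uv uw vw
    x (≢-sym (adj⇒≢ G ux)) x≢v x≢w nbrs-u
    y y≢u (≢-sym (adj⇒≢ G vy)) y≢w nbrs-v
    c (colouring⇒properAt (delete2 G u v) c c-colouring)

lemma2p2 : ∀ (n : ℕ) (G : Graph n) (P : PlaneEmbedding G) →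
    ¬ HasC4 G → ¬ HasC5 G →
    ¬ Colourable110G G →
    (∀ (H : Subgraph G) → Proper H → Colourable110 H) →
    ∀ (u v w : Fin n) → Is3Face P u v w → ¬ Is334⁻ (deg G u) (deg G v) (deg G w)
lemma2p2 n G P _ _ uncolourable minimal u v w (uv , rot-vu , rot-wv , _) = degrees
  where
  vw : Adj G v w
  vw = subst (Adj G v) rot-vu (rot-nbr P v u (adj-sym G uv))

  wu : Adj G w u
  wu = subst (Adj G w) rot-wv (rot-nbr P w v (adj-sym G vw))

  degrees : ¬ Is334⁻ (deg G u) (deg G v) (deg G w)
  degrees (inj₁ (du , dv , dw)) =
    noReducibleTriangle G uncolourable minimal u v w uv (adj-sym G wu) vw du dv dw
  degrees (inj₂ (inj₁ (du , dw , dv))) =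
    noReducibleTriangle G uncolourable minimal u w v (adj-sym G wu) uv (adj-sym G vw) du dw dv
  degrees (inj₂ (inj₂ (dv , dw , du))) =
    noReducibleTriangle G uncolourable minimal v w u vw (adj-sym G uv) wu dv dw du
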